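{- Let $f(x), d(x) \in \mathbb{F}_2[x]$ with $f(x)$ nonzero and $\deg d > 0$. There exists $g(x) \in \mathbb{F}_2[x]$ with $\deg g \le \deg f$ such that $\gcd(d, g) = 1$ and $L_2(f-g) \le \deg d$. Furthermore, if also $\deg d \le \deg f$, then $g$ can be chosen with $\deg g = \deg f$.
   Context: For $h \in \mathbb{F}_2[x]$, $L_2(h)$ denotes the number of nonzero coefficients of $h$ (the coefficients are represented by $0$ or $1$ and their absolute values summed). The degree of the zero polynomial is $-\infty$. -}

module Defs where

open import Data.Bool using (Bool; true; false; _xor_; if_then_else_)
open import Data.List using (List; []; _∷_; length)
open import Data.Nat using (ℕ; zero; suc; _∸_) renaming (_≤_ to _≤ℕ_; _<_ to _<ℕ_)
open import Data.Product using (Σ; _×_)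
open import Relation.Binary.PropositionalEquality using (_≡_)

-- Polynomials over F₂ = Bool (true = 1, false = 0, addition = xor, multiplication = ∧),
-- represented by coefficient lists, lowest degree first: a₀ ∷ a₁ ∷ … means a₀ + a₁ x + ….
-- Trailing zero coefficients are allowed; equality of polynomials is _≈_ below.
Poly : Set
Poly = List Bool

0ₚ : Poly
0ₚ = []

1ₚ : Poly
1ₚ = true ∷ []

private
  consN : Bool → Poly → Poly
  consN false [] = []
  consN true  [] = true ∷ []
  consN a (b ∷ r) = a ∷ b ∷ r

normalize : Poly → Poly
normalize []      = []
normalize (a ∷ p) = consN a (normalize p)

_≈_ : Poly → Poly → Set
p ≈ q = normalize p ≡ normalize q

infixl 6 _+ₚ_ _-ₚ_
infixl 7 _*ₚ_
infix 4 _≈_ _∣ₚ_ _≤ᵈ_ _<ᵈ_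

_+ₚ_ : Poly → Poly → Poly
[]      +ₚ q       = q
(a ∷ p) +ₚ []      = a ∷ p
(a ∷ p) +ₚ (b ∷ q) = (a xor b) ∷ (p +ₚ q)

-- in F₂, -1 = 1, so subtraction is addition
_-ₚ_ : Poly → Poly → Poly
p -ₚ q = p +ₚ q

_*ₚ_ : Poly → Poly → Poly
[]      *ₚ q = []
(a ∷ p) *ₚ q = (if a then q else []) +ₚ (false ∷ (p *ₚ q))

data Deg : Set where
  -∞  : Deg
  fin : ℕ → Deg

data _≤ᵈ_ : Deg → Deg → Set where
  -∞≤   : ∀ {e} → -∞ ≤ᵈ e
  fin≤  : ∀ {m n} → m ≤ℕ n → fin m ≤ᵈ fin n

data _<ᵈ_ : Deg → Deg → Set where
  -∞<fin : ∀ {n} → -∞ <ᵈ fin n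
  fin<   : ∀ {m n} → m <ℕ n → fin m <ᵈ fin n

deg : Poly → Deg
deg p with normalize p
... | []      = -∞
... | (x ∷ r) = fin (length r)

L₂ : Poly → ℕ
L₂ []          = 0
L₂ (false ∷ p) = L₂ p
L₂ (true ∷ p)  = suc (L₂ p)

_∣ₚ_ : Poly → Poly → Set
h ∣ₚ p = Σ Poly (λ q → q *ₚ h ≈ p)

IsGCD : Poly → Poly → Poly → Set
IsGCD a b c = (c ∣ₚ a) × (c ∣ₚ b) × (∀ h → h ∣ₚ a → h ∣ₚ b → h ∣ₚ c)

module Submission where

-- Write n = deg d ≥ 1 and m = deg f.  Over F₂ every
-- nonzero polynomial is monic, so f can be divided by d: f = q·d + s with
-- deg s < n.
--   * If m ≥ n, take g = q·d + 1.  Any common divisor of d and g divides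
--     g - q·d = 1, so gcd(d, g) = 1; f - g = s + 1 has degree < n (as n ≥ 1),
--     hence at most n nonzero coefficients; and g = f + (s + 1) differs from f
--     only below degree n ≤ m, so deg g = deg f.
--   * If m < n, take g = 1: gcd(d, 1) = 1 and f - 1 has at most m + 1 ≤ n
--     nonzero coefficients.  The second claim is vacuous in this case.

open import Defs
open import Data.Bool using (true; false; _xor_; if_then_else_)
open import Data.Bool.Properties using (xor-comm; xor-assoc; xor-same)
open import Data.Empty using (⊥-elim)
open import Data.List using ([]; _∷_; length; _++_)
open import Data.List.Properties using (length-++-sucʳ; ++-identityʳ)
open import Data.Nat using (ℕ; zero; suc; z≤n; s≤s) renaming (_≤_ to _≤ℕ_; _<_ to _<ℕ_)
open import Data.Nat.Properties using (≤-refl; ≤-trans; n≤1+n; <⇒≱; <-≤-connex)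
open import Data.Product using (Σ; _×_; _,_)
open import Data.Sum using (_⊎_; inj₁; inj₂)
open import Relation.Binary.PropositionalEquality
  using (_≡_; refl; sym; trans; cong; cong₂; subst)
open import Relation.Nullary using (¬_)
open Relation.Binary.PropositionalEquality.≡-Reasoning

-- Equality of polynomials, inductively: two coefficient lists are equal when
-- they agree up to trailing zeros.  It coincides with _≈_ (see ~⇒≈, ≈⇒~) and
-- is far more convenient for proving congruences.
infix 4 _~_
data _~_ : Poly → Poly → Set where
  nil  : [] ~ []
  nilL : ∀ {p} → [] ~ p → [] ~ (false ∷ p)
  nilR : ∀ {p} → p ~ [] → (false ∷ p) ~ []
  cons : ∀ {a p q} → p ~ q → (a ∷ p) ~ (a ∷ q)

~-refl : ∀ p → p ~ p
~-refl []      = nil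
~-refl (a ∷ p) = cons (~-refl p)

~-sym : ∀ {p q} → p ~ q → q ~ p
~-sym nil      = nil
~-sym (nilL h) = nilR (~-sym h)
~-sym (nilR h) = nilL (~-sym h)
~-sym (cons h) = cons (~-sym h)

~-trans : ∀ {p q r} → p ~ q → q ~ r → p ~ r
~-trans nil      k        = k
~-trans (nilL h) (nilR k) = ~-trans h k
~-trans (nilL h) (cons k) = nilL (~-trans h k)
~-trans (nilR h) nil      = nilR h
~-trans (nilR h) (nilL k) = cons (~-trans h k)
~-trans (cons h) (nilR k) = nilR (~-trans h k)
~-trans (cons h) (cons k) = cons (~-trans h k)

≡⇒~ : ∀ {p q} → p ≡ q → p ~ q
≡⇒~ {p} refl = ~-refl p

~-normalize : ∀ p → p ~ normalize p
~-normalize []      = nil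
~-normalize (a ∷ p) with normalize p | ~-normalize p | a
... | []    | h | false = nilR h
... | []    | h | true  = cons h
... | b ∷ r | h | false = cons h
... | b ∷ r | h | true  = cons h

~⇒≈ : ∀ {p q} → p ~ q → p ≈ q
~⇒≈ nil                = refl
~⇒≈ (nilL h) rewrite sym (~⇒≈ h) = refl
~⇒≈ (nilR h) rewrite ~⇒≈ h = refl
~⇒≈ (cons h) rewrite ~⇒≈ h = refl

≈⇒~ : ∀ {p q} → p ≈ q → p ~ q
≈⇒~ {p} {q} e =
  ~-trans (~-normalize p) (subst (_~ q) (sym e) (~-sym (~-normalize q)))

+-identityʳ : ∀ p → p +ₚ [] ≡ p
+-identityʳ []      = refl
+-identityʳ (a ∷ p) = refl

+-comm : ∀ p q → p +ₚ q ≡ q +ₚ p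
+-comm []      q       = sym (+-identityʳ q)
+-comm (a ∷ p) []      = refl
+-comm (a ∷ p) (b ∷ q) = cong₂ _∷_ (xor-comm a b) (+-comm p q)

+-assoc : ∀ p q r → (p +ₚ q) +ₚ r ≡ p +ₚ (q +ₚ r)
+-assoc []      q       r       = refl
+-assoc (a ∷ p) []      r       = refl
+-assoc (a ∷ p) (b ∷ q) []      = refl
+-assoc (a ∷ p) (b ∷ q) (c ∷ r) = cong₂ _∷_ (xor-assoc a b c) (+-assoc p q r)

+-self : ∀ p → p +ₚ p ~ []
+-self []      = nil
+-self (a ∷ p) rewrite xor-same a = nilR (+-self p)

+-congˡ : ∀ {p p'} q → p ~ p' → p +ₚ q ~ p' +ₚ q
+-congˡ q       nil      = ~-refl q
+-congˡ []      (nilL h) = nilL h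
+-congˡ (b ∷ q) (nilL h) = cons (+-congˡ q h)
+-congˡ []      (nilR h) = nilR h
+-congˡ (b ∷ q) (nilR h) = cons (+-congˡ q h)
+-congˡ []      (cons h) = cons h
+-congˡ (b ∷ q) (cons h) = cons (+-congˡ q h)

+-cong : ∀ {p p' q q'} → p ~ p' → q ~ q' → p +ₚ q ~ p' +ₚ q'
+-cong {p} {p'} {q} {q'} h k =
  ~-trans (+-congˡ q h)
    (along (+-comm q p') (+-comm q' p') (+-congˡ p' k))
  where
  along : ∀ {a b c e} → a ≡ b → c ≡ e → a ~ c → b ~ e
  along refl refl x = x

+-cancelˡ : ∀ {f g t} → g ~ f +ₚ t → f +ₚ g ~ t
+-cancelˡ {f} {t = t} h =
  ~-trans (+-cong (~-refl f) h)
    (~-trans (≡⇒~ (sym (+-assoc f f t))) (+-congˡ t (+-self f)))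

+-interchange : ∀ a b c e → (a +ₚ b) +ₚ (c +ₚ e) ≡ (a +ₚ c) +ₚ (b +ₚ e)
+-interchange a b c e = begin
  (a +ₚ b) +ₚ (c +ₚ e) ≡⟨ +-assoc a b (c +ₚ e) ⟩
  a +ₚ (b +ₚ (c +ₚ e)) ≡⟨ cong (a +ₚ_) (sym (+-assoc b c e)) ⟩
  a +ₚ ((b +ₚ c) +ₚ e) ≡⟨ cong (λ z → a +ₚ (z +ₚ e)) (+-comm b c) ⟩
  a +ₚ ((c +ₚ b) +ₚ e) ≡⟨ cong (a +ₚ_) (+-assoc c b e) ⟩
  a +ₚ (c +ₚ (b +ₚ e)) ≡⟨ sym (+-assoc a c (b +ₚ e)) ⟩
  (a +ₚ c) +ₚ (b +ₚ e) ∎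

-- Multiplication: the laws used to cancel q·d in the coprimality argument.
-- The scalar multiple "if a then h else []" is a·h for a ∈ F₂.
scale-cong : ∀ a {h h'} → h ~ h' → (if a then h else []) ~ (if a then h' else [])
scale-cong true  k = k
scale-cong false k = nil

scale-xor : ∀ a b h →
  (if a xor b then h else []) ~ (if a then h else []) +ₚ (if b then h else [])
scale-xor true  true  h = ~-sym (+-self h)
scale-xor true  false h = ~-sym (≡⇒~ (+-identityʳ h))
scale-xor false true  h = ~-refl h
scale-xor false false h = nil

scale-* : ∀ c a h → (if c then a else []) *ₚ h ~ (if c then a *ₚ h else [])
scale-* true  a h = ~-refl (a *ₚ h)
scale-* false a h = nil

*-congʳ : ∀ x {h h'} → h ~ h' → x *ₚ h ~ x *ₚ h'
*-congʳ []      k = nil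
*-congʳ (a ∷ x) k = +-cong (scale-cong a k) (cons (*-congʳ x k))

*-distribʳ-+ : ∀ x y h → (x +ₚ y) *ₚ h ~ x *ₚ h +ₚ y *ₚ h
*-distribʳ-+ []      y       h = ~-refl (y *ₚ h)
*-distribʳ-+ (a ∷ x) []      h = ~-sym (≡⇒~ (+-identityʳ ((a ∷ x) *ₚ h)))
*-distribʳ-+ (a ∷ x) (b ∷ y) h =
  ~-trans (+-cong (scale-xor a b h) (cons (*-distribʳ-+ x y h)))
    (≡⇒~ (+-interchange (if a then h else []) (if b then h else [])
                        (false ∷ (x *ₚ h)) (false ∷ (y *ₚ h))))

*-assoc : ∀ q a h → (q *ₚ a) *ₚ h ~ q *ₚ (a *ₚ h)
*-assoc []      a h = nil
*-assoc (c ∷ q) a h =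
  ~-trans (*-distribʳ-+ (if c then a else []) (false ∷ (q *ₚ a)) h)
    (+-cong (scale-* c a h) (cons (*-assoc q a h)))

*-identityʳ : ∀ p → p *ₚ 1ₚ ~ p
*-identityʳ []          = nil
*-identityʳ (true ∷ p)  = cons (*-identityʳ p)
*-identityʳ (false ∷ p) = cons (*-identityʳ p)

-- monic e is the monic polynomial e₀ + e₁x + … + x^(length e) of degree
-- length e.  Over F₂ every nonzero polynomial is equal to one of these.
monic : Poly → Poly
monic e = e ++ true ∷ []

data ZeroOrMonic (p : Poly) : Set where
  zero≈  : p ~ [] → ZeroOrMonic p
  monic≈ : (e : Poly) → p ~ monic e → ZeroOrMonic p

-- Scanning from the top coefficient: the first 1 found is the leading one.
zeroOrMonic : ∀ p → ZeroOrMonic p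
zeroOrMonic []      = zero≈ nil
zeroOrMonic (a ∷ p) with zeroOrMonic p
zeroOrMonic (false ∷ p) | zero≈ h    = zero≈ (nilR h)
zeroOrMonic (true ∷ p)  | zero≈ h    = monic≈ [] (cons h)
zeroOrMonic (a ∷ p)     | monic≈ e h = monic≈ (a ∷ e) (cons h)

length-monic : ∀ e → length (monic e) ≡ suc (length e)
length-monic e = trans (length-++-sucʳ e true []) (cong (λ z → suc (length z)) (++-identityʳ e))

-- A monic polynomial has no trailing zeros, so it is its own normal form.
normalize-monic : ∀ e → normalize (monic e) ≡ monic e
normalize-monic []               = refl
normalize-monic (false ∷ [])     = refl
normalize-monic (true ∷ [])      = refl
normalize-monic (false ∷ c ∷ e) rewrite normalize-monic (c ∷ e) = refl
normalize-monic (true ∷ c ∷ e)  rewrite normalize-monic (c ∷ e) = refl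

degOfNormal : Poly → Deg
degOfNormal []      = -∞
degOfNormal (x ∷ r) = fin (length r)

deg-normalize : ∀ p → deg p ≡ degOfNormal (normalize p)
deg-normalize p with normalize p
... | []    = refl
... | x ∷ r = refl

deg-~ : ∀ {p q} → p ~ q → deg p ≡ deg q
deg-~ {p} {q} h =
  trans (deg-normalize p) (trans (cong degOfNormal (~⇒≈ h)) (sym (deg-normalize q)))

deg-monic : ∀ {p} e → p ~ monic e → deg p ≡ fin (length e)
deg-monic {p} [] h      = deg-~ h
deg-monic {p} (c ∷ e) h = begin
  deg p                             ≡⟨ deg-~ h ⟩
  deg (monic (c ∷ e))               ≡⟨ deg-normalize (monic (c ∷ e)) ⟩
  degOfNormal (normalize (monic (c ∷ e))) ≡⟨ cong degOfNormal (normalize-monic (c ∷ e)) ⟩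
  fin (length (monic e))            ≡⟨ cong fin (length-monic e) ⟩
  fin (length (c ∷ e))              ∎

-- Short n p: all coefficients of p of index ≥ n vanish, i.e. deg p < n.
data Short : ℕ → Poly → Set where
  short[] : ∀ {n} → Short n []
  short∷  : ∀ {n a p} → Short n p → Short (suc n) (a ∷ p)
  short0  : ∀ {p} → Short 0 p → Short 0 (false ∷ p)

short-≤ : ∀ {m n t} → m ≤ℕ n → Short m t → Short n t
short-≤ _               short[]    = short[]
short-≤ (s≤s le)        (short∷ h) = short∷ (short-≤ le h)
short-≤ {n = zero}  z≤n (short0 h) = short0 h
short-≤ {n = suc n} z≤n (short0 h) = short∷ (short-≤ z≤n h)

short0⇒~[] : ∀ {t} → Short 0 t → t ~ []
short0⇒~[] short[]    = nil
short0⇒~[] (short0 h) = nilR (short0⇒~[] h)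

short-monic : ∀ e → Short (suc (length e)) (monic e)
short-monic []      = short∷ short[]
short-monic (c ∷ e) = short∷ (short-monic e)

short-+1 : ∀ {n t} → 0 <ℕ n → Short n t → Short n (t +ₚ 1ₚ)
short-+1 (s≤s _) short[]                = short∷ short[]
short-+1 (s≤s _) (short∷ {a = a} {p} h) rewrite +-identityʳ p = short∷ h

short-L₂ : ∀ {n t} → Short n t → L₂ t ≤ℕ n
short-L₂ short[]                  = z≤n
short-L₂ (short∷ {a = true}  h)   = s≤s (short-L₂ h)
short-L₂ (short∷ {a = false} h)   = ≤-trans (short-L₂ h) (n≤1+n _)
short-L₂ (short0 h)               = short-L₂ h

L₂-~ : ∀ {p q} → p ~ q → L₂ p ≡ L₂ q
L₂-~ nil               = refl
L₂-~ (nilL h)          = L₂-~ h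
L₂-~ (nilR h)          = L₂-~ h
L₂-~ (cons {true} h)   = cong suc (L₂-~ h)
L₂-~ (cons {false} h)  = L₂-~ h

monic-+-short : ∀ e t → Short (length e) t →
  Σ Poly λ e' → (monic e +ₚ t ~ monic e') × length e' ≡ length e
monic-+-short []      []          _          = [] , ~-refl _ , refl
monic-+-short []      (false ∷ t) (short0 h) = [] , cons (short0⇒~[] h) , refl
monic-+-short (c ∷ e) []          _          = (c ∷ e) , ~-refl _ , refl
monic-+-short (c ∷ e) (b ∷ t)     (short∷ h) with monic-+-short e t h
... | e' , k , l = (c xor b) ∷ e' , cons k , cong suc l

deg-monic-+-short : ∀ {p} e t → p ~ monic e → Short (length e) t →
  deg (p +ₚ t) ≡ fin (length e)
deg-monic-+-short e t h sh with monic-+-short e t sh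
... | e' , k , l = trans (deg-monic e' (~-trans (+-congˡ t h) k)) (cong fin l)

-- Division with remainder by a monic polynomial D = monic e:
-- f + s = q·D with deg s < deg D.  (Over F₂, f + s = f - s.)
record Division (e f : Poly) : Set where
  field
    quot rem  : Poly
    rem-short : Short (length e) rem
    f+rem     : f +ₚ rem ~ quot *ₚ monic e

reduce : ∀ e t → Short (suc (length e)) t →
  Short (length e) t ⊎ Short (length e) (t +ₚ monic e)
reduce e        []          _          = inj₁ short[]
reduce []       (false ∷ p) (short∷ h) = inj₁ (short0 h)
reduce []       (true ∷ p)  (short∷ h) rewrite +-identityʳ p = inj₂ (short0 h)
reduce (c ∷ e)  (a ∷ p)     (short∷ h) with reduce e p h
... | inj₁ k = inj₁ (short∷ k)
... | inj₂ k = inj₂ (short∷ k)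

-- Horner-style division: from f = q·D + s we get a ∷ f = x·f + a with
-- remainder a ∷ s, reduced once more if its degree reached deg D.
divide : ∀ e f → Division e f
divide e []      = record { quot = [] ; rem = [] ; rem-short = short[] ; f+rem = nil }
divide e (a ∷ f) with divide e f
... | record { quot = q ; rem = s ; rem-short = sh ; f+rem = h }
    with reduce e (a ∷ s) (short∷ sh)
...   | inj₁ k = record { quot = false ∷ q ; rem = a ∷ s ; rem-short = k ; f+rem = shifted }
  where
  shifted : (a ∷ f) +ₚ (a ∷ s) ~ false ∷ (q *ₚ monic e)
  shifted rewrite xor-same a = cons h
...   | inj₂ k =
  record { quot = true ∷ q ; rem = (a ∷ s) +ₚ monic e ; rem-short = k ; f+rem = reduced }
  where
  shifted : (a ∷ f) +ₚ (a ∷ s) ~ false ∷ (q *ₚ monic e)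
  shifted rewrite xor-same a = cons h
  reduced : (a ∷ f) +ₚ ((a ∷ s) +ₚ monic e) ~ (true ∷ q) *ₚ monic e
  reduced = ~-trans (≡⇒~ (sym (+-assoc (a ∷ f) (a ∷ s) (monic e))))
              (~-trans (+-congˡ (monic e) shifted)
                (≡⇒~ (+-comm (false ∷ (q *ₚ monic e)) (monic e))))

isGCD-one : ∀ d g → (∀ h → h ∣ₚ d → h ∣ₚ g → h ∣ₚ 1ₚ) → IsGCD d g 1ₚ
isGCD-one d g common = (d , ~⇒≈ (*-identityʳ d)) , (g , ~⇒≈ (*-identityʳ g)) , common

-- q·d + 1 is coprime to d: a common divisor h, with a·h = d and b·h = q·d + 1,
-- divides (b + q·a)·h = (q·d + 1) + q·d = 1.
coprime-multiple+1 : ∀ d q → IsGCD d (q *ₚ d +ₚ 1ₚ) 1ₚ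
coprime-multiple+1 d q = isGCD-one d (q *ₚ d +ₚ 1ₚ) common
  where
  X = q *ₚ d
  common : ∀ h → h ∣ₚ d → h ∣ₚ X +ₚ 1ₚ → h ∣ₚ 1ₚ
  common h (a , ah≈d) (b , bh≈g) = (b +ₚ q *ₚ a) , ~⇒≈ combination
    where
    -- (b + q·a)·h = b·h + q·(a·h) = (X + 1) + X = 1 + (X + X) = 1
    combination : (b +ₚ q *ₚ a) *ₚ h ~ 1ₚ
    combination =
      ~-trans (*-distribʳ-+ b (q *ₚ a) h)
      (~-trans (+-cong (≈⇒~ bh≈g) (~-trans (*-assoc q a h) (*-congʳ q (≈⇒~ ah≈d))))
      (~-trans (≡⇒~ (trans (cong (_+ₚ X) (+-comm X 1ₚ)) (+-assoc 1ₚ X X)))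
        (+-cong (~-refl 1ₚ) (+-self X))))

Approximates : Poly → Poly → Poly → Set
Approximates d f g = IsGCD d g 1ₚ × (fin (L₂ (f -ₚ g)) ≤ᵈ deg d)

-- Case deg f < deg d: g = 1 works, since f - 1 has at most deg f + 1
-- nonzero coefficients.
approx-small : ∀ {f d} ed ef → d ~ monic ed → f ~ monic ef → length ef <ℕ length ed →
  (deg 1ₚ ≤ᵈ deg f) × Approximates d f 1ₚ
approx-small {f} {d} ed ef d≈ f≈ m<n =
  subst (fin 0 ≤ᵈ_) (sym (deg-monic ef f≈)) (fin≤ z≤n) ,
  isGCD-one d 1ₚ (λ h _ h∣1 → h∣1) ,
  subst (fin (L₂ (f +ₚ 1ₚ)) ≤ᵈ_) (sym (deg-monic ed d≈)) (fin≤ few)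
  where
  few : L₂ (f +ₚ 1ₚ) ≤ℕ length ed
  few = subst (_≤ℕ length ed) (sym (L₂-~ (+-congˡ 1ₚ f≈)))
          (short-L₂ (short-≤ m<n (short-+1 (s≤s z≤n) (short-monic ef))))

approx-large : ∀ {f d} ed ef → d ~ monic ed → 0 <ℕ length ed →
  f ~ monic ef → length ed ≤ℕ length ef →
  Σ Poly λ g → (deg g ≡ deg f) × Approximates d f g
approx-large {f} {d} ed ef d≈ n>0 f≈ n≤m =
  g , deg-g , coprime-multiple+1 d q , subst (fin (L₂ (f +ₚ g)) ≤ᵈ_) (sym (deg-monic ed d≈)) few
  where
  open Division (divide ed f) renaming (quot to q; rem to s)
  g = q *ₚ d +ₚ 1ₚ
  t = s +ₚ 1ₚ
  t-short : Short (length ed) t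
  t-short = short-+1 n>0 rem-short
  -- g = q·D + 1 = (f + s) + 1 = f + t
  g≈f+t : g ~ f +ₚ t
  g≈f+t = ~-trans (+-congˡ 1ₚ (~-trans (*-congʳ q d≈) (~-sym f+rem))) (≡⇒~ (+-assoc f s 1ₚ))
  few : fin (L₂ (f +ₚ g)) ≤ᵈ fin (length ed)
  few rewrite L₂-~ (+-cancelˡ {f} g≈f+t) = fin≤ (short-L₂ t-short)
  deg-g : deg g ≡ deg f
  deg-g = begin
    deg g          ≡⟨ deg-~ g≈f+t ⟩
    deg (f +ₚ t)   ≡⟨ deg-monic-+-short ef t f≈ (short-≤ n≤m t-short) ⟩
    fin (length ef) ≡⟨ sym (deg-monic ef f≈) ⟩
    deg f          ∎

≤ᵈ-refl : ∀ x → x ≤ᵈ x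
≤ᵈ-refl -∞      = -∞≤
≤ᵈ-refl (fin m) = fin≤ ≤-refl

fin-≤ᵈ : ∀ {x y m n} → x ≡ fin m → y ≡ fin n → x ≤ᵈ y → m ≤ℕ n
fin-≤ᵈ refl refl (fin≤ p) = p

deg-pos-nonzero : ∀ {d} → d ~ [] → ¬ (fin 0 <ᵈ deg d)
deg-pos-nonzero d≈0 pos with subst (fin 0 <ᵈ_) (deg-~ d≈0) pos
... | ()

deg-pos : ∀ {d e} → d ~ monic e → fin 0 <ᵈ deg d → 0 <ℕ length e
deg-pos {e = e} d≈ pos with subst (fin 0 <ᵈ_) (deg-monic e d≈) pos
... | fin< p = p

lemma3p4 : (f d : Poly) → ¬ (f ≈ 0ₚ) → fin 0 <ᵈ deg d →
    Σ Poly (λ g → (deg g ≤ᵈ deg f) × IsGCD d g 1ₚ × (fin (L₂ (f -ₚ g)) ≤ᵈ deg d))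
    × (deg d ≤ᵈ deg f →
    Σ Poly (λ g → (deg g ≡ deg f) × IsGCD d g 1ₚ × (fin (L₂ (f -ₚ g)) ≤ᵈ deg d)))
lemma3p4 f d f≠0 pos with zeroOrMonic d | zeroOrMonic f
... | zero≈ d≈0 | _ = ⊥-elim (deg-pos-nonzero d≈0 pos)
lemma3p4 f d f≠0 pos | monic≈ _ _ | zero≈ f≈0 = ⊥-elim (f≠0 (~⇒≈ f≈0))
lemma3p4 f d f≠0 pos | monic≈ ed d≈ | monic≈ ef f≈ with <-≤-connex (length ef) (length ed)
... | inj₁ m<n = (1ₚ , approx-small ed ef d≈ f≈ m<n) , λ d≤f →
      ⊥-elim (<⇒≱ m<n (fin-≤ᵈ (deg-monic ed d≈) (deg-monic ef f≈) d≤f))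
... | inj₂ n≤m with approx-large ed ef d≈ (deg-pos d≈ pos) f≈ n≤m
...   | g , deg-g , approx = (g , subst (deg g ≤ᵈ_) deg-g (≤ᵈ-refl (deg g)) , approx) , λ _ →
        (g , deg-g , approx)
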